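{- For every non-negative integer $n$, $T(n) \neq 2$.
   Context: A square-product sequence is a strictly increasing finite sequence of integers $a_1 < a_2 < \cdots < a_t$ ($t \geq 1$) whose product $a_1 a_2 \cdots a_t$ is a perfect square (the square of an integer). For a non-negative integer $n$, $g(n)$ is the least integer $k$ such that there exists a square-product sequence $n = a_1 < a_2 < \cdots < a_t = k$. A corresponding sequence for $g(n)$ is a square-product sequence whose first term is $n$ and whose last term is $g(n)$. $T(n)$ is the least $t$ such that there exists a corresponding sequence $n = a_1 < \cdots < a_t = g(n)$ of length $t$. -}

module Defs where

open import Data.Nat using (ℕ; _*_; _≤_; _<_)
open import Data.List using (List; head; last; length)
open import Data.Nat.ListAction using (product)
open import Data.List.Relation.Unary.Linked using (Linked)
open import Data.Maybe using (just)
open import Data.Product using (Σ; ∃; _×_)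
open import Relation.Binary.PropositionalEquality using (_≡_)

IsSquare : ℕ → Set
IsSquare m = ∃ λ r → r * r ≡ m

-- xs is a square-product sequence (strictly increasing, product a square)
-- with first term n and last term k (hence t = length xs ≥ 1).
-- Terms are ≥ n ≥ 0, so natural numbers suffice.
SqSeq : ℕ → ℕ → List ℕ → Set
SqSeq n k xs =
  head xs ≡ just n × last xs ≡ just k × Linked _<_ xs × IsSquare (product xs)

Reach : ℕ → ℕ → Set
Reach n k = ∃ λ xs → SqSeq n k xs

IsG : ℕ → ℕ → Set
IsG n k = Reach n k × (∀ k′ → Reach n k′ → k ≤ k′)

IsT : ℕ → ℕ → Set
IsT n t = Σ ℕ λ k → IsG n k
  × (∃ λ xs → SqSeq n k xs × length xs ≡ t)
  × (∀ xs → SqSeq n k xs → t ≤ length xs)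

-- If T(n) = 2 then g(n) = k with n < k and n k a square, so n = d a² and k = d b² with a < b.
-- When n is itself a square, the one-term sequence gives g(n) = n < k.  Otherwise d ≥ 2 and
-- a ≥ 1, and the four terms d a², a(da+1), da(a+1), (a+1)(da+1) are increasing with product
-- (d a² (a+1)(da+1))², while (a+1)(da+1) < d (a+1)² ≤ k, contradicting the minimality of k.
module Submission where

open import Defs
open import Data.Nat using (ℕ; zero; suc; _+_; _*_; _≤_; _<_; NonZero; z≤n; s≤s; z<s; ≢-nonZero)
open import Data.Nat.Properties
open import Data.Nat.Divisibility using (_∣_; divides)
open import Data.Nat.GCD using (gcd; GCD; gcd-GCD; GCD-*; gcd[m,n]∣m; gcd[m,n]∣n)
open import Data.Nat.Coprimality using (Coprime; GCD≡1⇒coprime; coprime-divisor)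
open import Data.Nat.Solver using (module +-*-Solver)
open import Data.List using ([]; _∷_)
open import Data.List.Relation.Unary.Linked using ([-]; _∷_)
open import Data.Product using (∃-syntax; _×_; _,_)
open import Data.Sum using (_⊎_; inj₁; inj₂)
open import Relation.Nullary using (¬_; yes; no; contradiction)
open import Relation.Binary.PropositionalEquality
  using (_≡_; _≢_; refl; sym; trans; cong; cong₂; subst; subst₂; module ≡-Reasoning)

open +-*-Solver

gcd-cofactors-coprime : ∀ {m n a b} .{{_ : NonZero (gcd m n)}} →
  m ≡ a * gcd m n → n ≡ b * gcd m n → Coprime a b
gcd-cofactors-coprime {m} {n} {a} {b} m≡a*g n≡b*g = GCD≡1⇒coprime (GCD-* gcd-scaled)
  where
  gcd-scaled : GCD (a * gcd m n) (b * gcd m n) (1 * gcd m n)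
  gcd-scaled = subst₂ (λ u v → GCD u v (1 * gcd m n)) m≡a*g n≡b*g
    (subst (GCD m n) (sym (*-identityˡ (gcd m n))) (gcd-GCD m n))

square-product-decomposition : ∀ {n k} → {{NonZero n}} → IsSquare (n * k) →
  ∃[ d ] ∃[ a ] ∃[ b ] n ≡ d * (a * a) × k ≡ d * (b * b)
square-product-decomposition {n} {k} {{n≢0}} (r , r*r≡n*k) =
  decompose (gcd[m,n]∣m n r) (gcd[m,n]∣n n r)
  where
  g : ℕ
  g = gcd n r
  decompose : g ∣ n → g ∣ r → ∃[ d ] ∃[ a ] ∃[ b ] n ≡ d * (a * a) × k ≡ d * (b * b)
  decompose (divides a n≡a*g) (divides b r≡b*g) =
    from-a∣g (coprime-divisor a⊥b (coprime-divisor a⊥b a∣b*b*g))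
    where
    instance
      a≢0 : NonZero a
      a≢0 = m*n≢0⇒m≢0 a {{subst NonZero n≡a*g n≢0}}
      g≢0 : NonZero g
      g≢0 = m*n≢0⇒n≢0 a {{subst NonZero n≡a*g n≢0}}
    a⊥b : Coprime a b
    a⊥b = gcd-cofactors-coprime n≡a*g r≡b*g
    a*k≡b*b*g : a * k ≡ b * (b * g)
    a*k≡b*b*g = *-cancelʳ-≡ (a * k) (b * (b * g)) g (begin
      a * k * g         ≡⟨ solve 3 (λ a k g → a :* k :* g := a :* g :* k) refl a k g ⟩
      a * g * k         ≡⟨ cong (_* k) (sym n≡a*g) ⟩
      n * k             ≡⟨ sym r*r≡n*k ⟩
      r * r             ≡⟨ cong₂ _*_ r≡b*g r≡b*g ⟩
      b * g * (b * g)   ≡⟨ solve 2 (λ b g → b :* g :* (b :* g) := b :* (b :* g) :* g) refl b g ⟩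
      b * (b * g) * g   ∎)
      where open ≡-Reasoning
    a∣b*b*g : a ∣ b * (b * g)
    a∣b*b*g = divides k (trans (sym a*k≡b*b*g) (*-comm a k))
    from-a∣g : a ∣ g → ∃[ d ] ∃[ a ] ∃[ b ] n ≡ d * (a * a) × k ≡ d * (b * b)
    from-a∣g (divides d g≡d*a) = d , a , b , n≡d*a*a , k≡d*b*b
      where
      n≡d*a*a : n ≡ d * (a * a)
      n≡d*a*a = begin
        n             ≡⟨ n≡a*g ⟩
        a * g         ≡⟨ cong (a *_) g≡d*a ⟩
        a * (d * a)   ≡⟨ solve 2 (λ a d → a :* (d :* a) := d :* (a :* a)) refl a d ⟩
        d * (a * a)   ∎
        where open ≡-Reasoning
      k≡d*b*b : k ≡ d * (b * b)
      k≡d*b*b = *-cancelˡ-≡ k (d * (b * b)) a (begin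
        a * k             ≡⟨ a*k≡b*b*g ⟩
        b * (b * g)       ≡⟨ cong (λ x → b * (b * x)) g≡d*a ⟩
        b * (b * (d * a)) ≡⟨ solve 3 (λ a b d → b :* (b :* (d :* a)) := a :* (d :* (b :* b))) refl a b d ⟩
        a * (d * (b * b)) ∎)
        where open ≡-Reasoning

square-reaches-itself : ∀ {n} → IsSquare n → Reach n n
square-reaches-itself {n} (r , r*r≡n) =
  n ∷ [] , refl , refl , [-] , r , trans r*r≡n (sym (*-identityʳ n))

square-cancel-< : ∀ {m n} → m * m < n * n → m < n
square-cancel-< {m} {n} m²<n² with m <? n
... | yes m<n = m<n
... | no m≮n = contradiction (*-mono-≤ (≮⇒≥ m≮n) (≮⇒≥ m≮n)) (<⇒≱ m²<n²)

m<n*m : ∀ {m n} → 0 < m → 1 < n → m < n * m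
m<n*m {m} {n} 0<m 1<n = subst (m <_) (*-comm m n) (m<m*n m n {{≢-nonZero (m<n⇒n≢0 0<m)}} 1<n)

-- The terms a(da+1), da(a+1), (a+1)(da+1) of the detour, written as d a² + a, d a² + da and
-- d a² + da + (a+1) so that the increase of the sequence is read off directly.
detour-end : ℕ → ℕ → ℕ
detour-end d a = d * (a * a) + d * a + suc a

detour : ∀ d a → 2 ≤ d → 1 ≤ a → Reach (d * (a * a)) (detour-end d a)
detour d a 2≤d 1≤a =
  d * (a * a) ∷ d * (a * a) + a ∷ d * (a * a) + d * a ∷ detour-end d a ∷ [] ,
  refl , refl ,
  m<m+n _ 1≤a ∷ +-monoʳ-< (d * (a * a)) (m<n*m 1≤a 2≤d) ∷ m<m+n _ z<s ∷ [-] ,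
  root , root²≡product
  where
  root : ℕ
  root = d * (a * (a * ((a + 1) * (d * a + 1))))
  root²≡product : root * root ≡
    d * (a * a) * ((d * (a * a) + a) * ((d * (a * a) + d * a) * (detour-end d a * 1)))
  root²≡product = solve 2 (λ d a →
    (d :* (a :* (a :* ((a :+ con 1) :* (d :* a :+ con 1))))) :*
    (d :* (a :* (a :* ((a :+ con 1) :* (d :* a :+ con 1)))))
      := d :* (a :* a) :* ((d :* (a :* a) :+ a) :* ((d :* (a :* a) :+ d :* a) :*
           ((d :* (a :* a) :+ d :* a :+ (con 1 :+ a)) :* con 1)))) refl d a

detour-end<next-scaled-square : ∀ {d a} → 2 ≤ d → 1 ≤ a → detour-end d a < d * (suc a * suc a)
detour-end<next-scaled-square {d} {a} 2≤d 1≤a = begin-strict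
  d * (a * a) + d * a + suc a       <⟨ +-monoʳ-< (d * (a * a) + d * a) suc-a<d*a+d ⟩
  d * (a * a) + d * a + (d * a + d) ≡⟨ solve 2 (λ d a →
    d :* (a :* a) :+ d :* a :+ (d :* a :+ d) := d :* ((con 1 :+ a) :* (con 1 :+ a))) refl d a ⟩
  d * (suc a * suc a)               ∎
  where
  open ≤-Reasoning
  suc-a<d*a+d : suc a < d * a + d
  suc-a<d*a+d = ≤-<-trans (m<n*m 1≤a 2≤d) (m<m+n (d * a) (≤-trans (s≤s z≤n) 2≤d))

scaled-square-cases : ∀ d a → IsSquare (d * (a * a)) ⊎ (2 ≤ d × 1 ≤ a)
scaled-square-cases zero          a       = inj₁ (0 , refl)
scaled-square-cases (suc zero)    a       = inj₁ (a , sym (*-identityˡ (a * a)))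
scaled-square-cases (suc (suc d)) zero    = inj₁ (0 , sym (*-zeroʳ (suc (suc d))))
scaled-square-cases (suc (suc d)) (suc a) = inj₂ (s≤s (s≤s z≤n) , s≤s z≤n)

scaled-square-partner-not-least : ∀ d a b → d * (a * a) < d * (b * b) →
  ¬ IsG (d * (a * a)) (d * (b * b))
scaled-square-partner-not-least d a b n<k (_ , least) with scaled-square-cases d a
... | inj₁ n-square = <⇒≱ n<k (least (d * (a * a)) (square-reaches-itself n-square))
... | inj₂ (2≤d , 1≤a) = <⇒≱ (<-≤-trans (detour-end<next-scaled-square 2≤d 1≤a) next≤k)
                              (least (detour-end d a) (detour d a 2≤d 1≤a))
  where
  a<b : a < b
  a<b = square-cancel-< (*-cancelˡ-< d (a * a) (b * b) n<k)
  next≤k : d * (suc a * suc a) ≤ d * (b * b)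
  next≤k = *-monoʳ-≤ d (*-mono-≤ a<b a<b)

square-partner-not-least : ∀ {n k} → n < k → IsSquare (n * k) → ¬ IsG n k
square-partner-not-least {zero} n<k _ (_ , least) =
  <⇒≱ n<k (least 0 (square-reaches-itself (0 , refl)))
square-partner-not-least {suc _} n<k nk-square =
  from-decomposition (square-product-decomposition nk-square) n<k
  where
  from-decomposition : ∀ {n k} → ∃[ d ] ∃[ a ] ∃[ b ] n ≡ d * (a * a) × k ≡ d * (b * b) →
    n < k → ¬ IsG n k
  from-decomposition (d , a , b , refl , refl) = scaled-square-partner-not-least d a b

theorem3p7 : (n t : ℕ) → IsT n t → t ≢ 2
theorem3p7 n t (k , isG , (x ∷ y ∷ [] , (refl , refl , x<y ∷ [-] , xy-square) , _) , _) refl =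
  square-partner-not-least x<y (subst (λ m → IsSquare (x * m)) (*-identityʳ y) xy-square) isG
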